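{- For every positive integer $t$, there exists a $t$-round algorithm which achieves a $2t$-approximation in the problem of parallel approximate maximum selection with adversarial comparators on $k$ items. The algorithm requires $O(k^{1 + \frac{1}{2^t-1}}t)$ queries.
   Context: Adversarial comparator model: $k$ items with unknown real values $x_1,\dots,x_k$; a query of a pair $i,j$ returns the item with larger value if $|x_i-x_j|>1$, and either item (chosen adversarially, possibly adaptively) if $|x_i-x_j|\le1$. Parallel setting with $t$ rounds: in each round the algorithm simultaneously submits a set of pairs (depending on earlier answers) and receives all answers; query complexity is the total number of pairs submitted. A value $x$ is a $\tau$-approximation of the maximum if $x\ge\max_i x_i-\tau$; achieving a $\tau$-approximation means outputting an item whose value is a $\tau$-approximation of the maximum, for all values and all adversarial comparators.
   Formalization: The item values $x_1,\dots,x_k$ are taken to be rational instead of real. -}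

module Defs where

open import Data.Nat as ℕ using (ℕ; zero; suc; _∸_)
open import Data.Integer using (+_)
open import Data.Rational using (ℚ; 1ℚ; _/_; _+_; _<_; _≤_)
open import Data.Fin using (Fin)
open import Data.Bool using (Bool; true; false)
open import Data.List using (List; length)
import Data.List as List
open import Data.Vec using (Vec)
import Data.Vec as Vec
open import Data.Product using (_×_; _,_; proj₁; proj₂)
open import Relation.Nullary using (¬_)

-- A pair query (i , j).  The answer is a Bool: true = the comparator returned i
-- (the first item), false = it returned j (the second item).
Query : ℕ → Set
Query k = Fin k × Fin k

-- A deterministic parallel algorithm with exactly r (possibly empty) rounds on
-- k items.
data Alg (k : ℕ) : ℕ → Set where
  done  : Fin k → Alg k zero
  round : ∀ {r} (qs : List (Query k)) →
          (Vec Bool (length qs) → Alg k r) → Alg k (suc r)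

ValidAnswer : ∀ {k} → (Fin k → ℚ) → Query k → Bool → Set
ValidAnswer x (i , j) true  = ¬ (x i + 1ℚ < x j)
ValidAnswer x (i , j) false = ¬ (x j + 1ℚ < x i)

ValidAnswers : ∀ {k} → (Fin k → ℚ) → (qs : List (Query k)) →
               Vec Bool (length qs) → Set
ValidAnswers x qs ans =
  ∀ p → ValidAnswer x (List.lookup qs p) (Vec.lookup ans p)

IsApproxMax : ∀ {k} → (Fin k → ℚ) → ℚ → Fin k → Set
IsApproxMax x τ out = ∀ j → x j ≤ x out + τ

-- Every execution of the algorithm against every (adaptive) adversarial
-- comparator for values x submits at most b queries in total and outputs a
-- τ-approximation of the maximum.  (An adaptive adversary is exactly an
-- arbitrary choice of valid answers at every round, depending on history.)
GoodRun : ∀ {k r} → (Fin k → ℚ) → ℚ → ℕ → Alg k r → Set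
GoodRun x τ b (done out)   = IsApproxMax x τ out
GoodRun x τ b (round qs f) =
  (length qs ℕ.≤ b) ×
  (∀ ans → ValidAnswers x qs ans → GoodRun x τ (b ∸ length qs) (f ans))

Achieves : ∀ {k r} → Alg k r → ℚ → ℕ → Set
Achieves A τ b = ∀ (x : Fin _ → ℚ) → GoodRun x τ b A

2t : ℕ → ℚ
2t t = + (2 ℕ.* t) / 1

-- A round-robin tournament is robust to the adversary: if some m exceeded an
-- item w that beat the most others by more than 2, every comparison that w won
-- would also be forced in favour of m, and so would m's comparison with w, so m
-- would have strictly more wins.  Running tournaments in disjoint groups
-- therefore keeps, for every item, a surviving candidate within 2 more of it per
-- round, and after t rounds the single survivor is a 2t-approximation.
--
-- For the cost, pad the k items to 2^e ≤ 2k candidates.  A round with groups of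
-- size 2^d on 2^E candidates asks 2^(E+d) queries, so with a per-round budget of
-- 2^(e+L) the exponent eliminated in a round may be as large as L plus everything
-- eliminated before; this doubles each round and t rounds eliminate (2^t − 1)L ≥ e.
-- With L = ⌊e/(2^t − 1)⌋ + 1 the total t·2^(e+L) is O(t k^(1 + 1/(2^t − 1))).
module Submission where

open import Defs
open import Data.Nat using (ℕ; zero; suc; pred; _+_; _*_; _^_; _∸_; _≤_; z≤n; s≤s; NonZero; >-nonZero)
import Data.Nat.Properties as ℕ
open import Data.Nat.DivMod using (_/_; _%_; _mod_; m≡m%n+[m/n]*n; m%n<n; m/n*n≤m; m<n⇒m%n≡m)
open import Data.Nat.Tactic.RingSolver using (solve-∀)
import Data.Nat.Coprimality as Coprime
open import Data.Integer as ℤ using (+_)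
import Data.Integer.Properties as ℤ
open import Data.Rational as ℚ using (ℚ; 0ℚ; 1ℚ; mkℚ)
import Data.Rational.Properties as ℚ
open import Data.Bool using (Bool; true; false)
open import Data.Fin using (Fin; zero; suc; toℕ; inject≤; combine; remQuot; cast)
open import Data.Fin.Properties using (toℕ-injective; toℕ-fromℕ<; toℕ-inject≤; toℕ<n; remQuot-combine; combine-surjective)
open import Data.Fin.Subset using (Subset; inside; outside; _∈_; _∉_; _⊆_; _⊂_; _─_; _-_; ∣_∣)
open import Data.Fin.Subset.Properties using (x∈⁅x⁆; p─q⊆p; x∈p∧x≢y⇒x∈p-y; p⊂q⇒∣p∣<∣q∣)
open import Data.Vec using (Vec; []; _∷_; tabulate; here; there)
import Data.Vec as Vec
open import Data.Vec.Properties using (lookup∘tabulate; []=⇒lookup; lookup⇒[]=)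
open import Data.List using (List; length; allFin)
import Data.List as List
open import Data.List.Properties using (length-tabulate; lookup-tabulate)
open import Data.List.Extrema.Nat using (argmax; f[xs]≤f[argmax])
open import Data.List.Membership.Propositional.Properties using (∈-allFin)
import Data.List.Relation.Unary.All as All
open import Data.Product using (Σ; ∃; ∃-syntax; _×_; _,_)
open import Data.Sum using (inj₁; inj₂)
open import Data.Empty using (⊥-elim)
open import Function using (_∘_)
open import Relation.Nullary using (yes; no)
open import Relation.Binary.PropositionalEquality

ℕ/1-+ : ∀ m n → + (m + n) ℚ./ 1 ≡ + m ℚ./ 1 ℚ.+ + n ℚ./ 1
ℕ/1-+ m n = begin
  + (m + n) ℚ./ 1                      ≡⟨ cong₂ (λ i j → (i ℤ.+ j) ℚ./ 1) (ℤ.*-identityʳ (+ m)) (ℤ.*-identityʳ (+ n)) ⟨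
  (+ m ℤ.* + 1 ℤ.+ + n ℤ.* + 1) ℚ./ 1  ≡⟨ cong₂ ℚ._+_ (ℕ/1≡mkℚ m) (ℕ/1≡mkℚ n) ⟨
  + m ℚ./ 1 ℚ.+ + n ℚ./ 1              ∎
  where
  open ≡-Reasoning
  ℕ/1≡mkℚ : ∀ n → + n ℚ./ 1 ≡ mkℚ (+ n) 0 (Coprime.sym (Coprime.1-coprimeTo n))
  ℕ/1≡mkℚ n = ℚ.normalize-coprime (Coprime.sym (Coprime.1-coprimeTo n))

2t-+ : ∀ m n → 2t (m + n) ≡ 2t m ℚ.+ 2t n
2t-+ m n = trans (cong (λ i → + i ℚ./ 1) (ℕ.*-distribˡ-+ 2 m n)) (ℕ/1-+ (2 * m) (2 * n))

p<p+1 : ∀ p → p ℚ.< p ℚ.+ 1ℚ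
p<p+1 p = subst (ℚ._< p ℚ.+ 1ℚ) (ℚ.+-identityʳ p) (ℚ.+-monoʳ-< p (ℚ.positive⁻¹ 1ℚ))

module _ {k} (x : Fin k → ℚ) {i j : Fin k} where

  ValidAnswer-true⇒≤ : ValidAnswer x (i , j) true → x j ℚ.≤ x i ℚ.+ 1ℚ
  ValidAnswer-true⇒≤ = ℚ.≮⇒≥

  ValidAnswer-forced : ∀ {b} → ValidAnswer x (i , j) b → x j ℚ.+ 1ℚ ℚ.< x i → b ≡ true
  ValidAnswer-forced {true}  _     _  = refl
  ValidAnswer-forced {false} valid lt = ⊥-elim (valid lt)

x∈p─q⇒x∉q : ∀ {n} {x : Fin n} (p q : Subset n) → x ∈ p ─ q → x ∉ q
x∈p─q⇒x∉q (inside ∷ p) (outside ∷ q) here        ()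
x∈p─q⇒x∉q (_      ∷ p) (_       ∷ q) (there x∈) (there x∈q) = x∈p─q⇒x∉q p q x∈ x∈q

x∉p-x : ∀ {n} (p : Subset n) (x : Fin n) → x ∉ p - x
x∉p-x p x x∈p-x = x∈p─q⇒x∉q p _ x∈p-x (x∈⁅x⁆ x)

∈-tabulate⁺ : ∀ {n} {f : Fin n → Bool} {x} → f x ≡ true → x ∈ tabulate f
∈-tabulate⁺ {f = f} {x} fx≡true = lookup⇒[]= x (tabulate f) (trans (lookup∘tabulate f x) fx≡true)

∈-tabulate⁻ : ∀ {n} {f : Fin n → Bool} {x} → x ∈ tabulate f → f x ≡ true
∈-tabulate⁻ {f = f} {x} x∈ = trans (sym (lookup∘tabulate f x)) ([]=⇒lookup x∈)

-- a p q = true means that the query (p , q) returned p.  The diagonal answers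
-- a p p are arbitrary, so p itself is never counted among the items it beat.
beaten : ∀ {n} → (Fin n → Fin n → Bool) → Fin n → Subset n
beaten a p = tabulate (a p) - p

score : ∀ {n} → (Fin n → Fin n → Bool) → Fin n → ℕ
score a p = ∣ beaten a p ∣

topScorer : ∀ {g} → (Fin (suc g) → Fin (suc g) → Bool) → Fin (suc g)
topScorer a = argmax (score a) zero (allFin _)

score≤score[topScorer] : ∀ {g} a (p : Fin (suc g)) → score a p ≤ score a (topScorer a)
score≤score[topScorer] a p = All.lookup (f[xs]≤f[argmax] {f = score a} zero (allFin _)) (∈-allFin p)

module _ {k n} (x : Fin k → ℚ) (member : Fin n → Fin k) (a : Fin n → Fin n → Bool)
         (valid : ∀ p q → ValidAnswer x (member p , member q) (a p q)) where

  beaten⊂beaten : ∀ {w m} → x (member w) ℚ.+ 2t 1 ℚ.< x (member m) → beaten a w ⊂ beaten a m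
  beaten⊂beaten {w} {m} w+2<m =
    w⊆m , w , beats-below w (ℚ.<⇒≤ (p<p+1 (x (member w)))) , x∉p-x (tabulate (a w)) w
    where
    beats-below : ∀ q → x (member q) ℚ.≤ x (member w) ℚ.+ 1ℚ → q ∈ beaten a m
    beats-below q q≤w+1 = x∈p∧x≢y⇒x∈p-y (∈-tabulate⁺ (ValidAnswer-forced x (valid m q) q+1<m)) q≢m
      where
      q+1<m : x (member q) ℚ.+ 1ℚ ℚ.< x (member m)
      q+1<m = ℚ.≤-<-trans
        (subst (x (member q) ℚ.+ 1ℚ ℚ.≤_) (ℚ.+-assoc (x (member w)) 1ℚ 1ℚ) (ℚ.+-monoˡ-≤ 1ℚ q≤w+1))
        w+2<m
      q≢m : q ≢ m
      q≢m refl = ℚ.<-asym (p<p+1 (x (member q))) q+1<m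
    w⊆m : beaten a w ⊆ beaten a m
    w⊆m {q} q∈ = beats-below q (ValidAnswer-true⇒≤ x
      (subst (ValidAnswer x (member w , member q)) (∈-tabulate⁻ (p─q⊆p _ _ q∈)) (valid w q)))

topScorer-approx : ∀ {k g} (x : Fin k → ℚ) (member : Fin (suc g) → Fin k) a →
                   (∀ p q → ValidAnswer x (member p , member q) (a p q)) →
                   ∀ q → x (member q) ℚ.≤ x (member (topScorer a)) ℚ.+ 2t 1
topScorer-approx x member a valid q = ℚ.≮⇒≥ λ w+2<q →
  ℕ.<⇒≱ (p⊂q⇒∣p∣<∣q∣ (beaten⊂beaten x member a valid w+2<q)) (score≤score[topScorer] a q)

-- An entry g of the vector means groups of size suc g in that round, first round first.
candidates : ∀ {r} → Vec ℕ r → ℕ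
candidates []       = 1
candidates (g ∷ gs) = suc g * candidates gs

queryCount : ∀ {r} → Vec ℕ r → ℕ
queryCount []       = 0
queryCount (g ∷ gs) = suc g * suc g * candidates gs + queryCount gs

Covers : ∀ {k n} → (Fin k → ℚ) → (Fin n → Fin k) → ℚ → Set
Covers x c σ = ∀ j → ∃[ i ] x j ℚ.≤ x (c i) ℚ.+ σ

module Round {k} (g R : ℕ) (c : Fin (suc g * R) → Fin k) where

  member : Fin R → Fin (suc g) → Fin k
  member r p = c (combine p r)

  pair : Fin R → Fin (suc g) × Fin (suc g) → Query k
  pair r (p , q) = member r p , member r q

  pairs : Fin (suc g * suc g * R) → Query k
  pairs i = let (pq , r) = remQuot R i in pair r (remQuot (suc g) pq)

  queries : List (Query k)
  queries = List.tabulate pairs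

  index : Fin R → Fin (suc g) → Fin (suc g) → Fin (length queries)
  index r p q = cast (sym (length-tabulate pairs)) (combine (combine p q) r)

  answer : Vec Bool (length queries) → Fin R → Fin (suc g) → Fin (suc g) → Bool
  answer ans r p q = Vec.lookup ans (index r p q)

  winners : Vec Bool (length queries) → Fin R → Fin k
  winners ans r = member r (topScorer (answer ans r))

  lookup-queries : ∀ r p q → List.lookup queries (index r p q) ≡ (member r p , member r q)
  lookup-queries r p q = begin
    List.lookup queries (index r p q)       ≡⟨ lookup-tabulate pairs (combine (combine p q) r) ⟩
    pairs (combine (combine p q) r)         ≡⟨ cong (λ (pq , r′) → pair r′ (remQuot (suc g) pq))
                                                    (remQuot-combine (combine p q) r) ⟩
    pair r (remQuot (suc g) (combine p q))  ≡⟨ cong (pair r) (remQuot-combine p q) ⟩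
    (member r p , member r q)               ∎
    where open ≡-Reasoning

  module _ (x : Fin k → ℚ) (ans : Vec Bool (length queries)) (valid : ValidAnswers x queries ans) where

    answer-valid : ∀ r p q → ValidAnswer x (member r p , member r q) (answer ans r p q)
    answer-valid r p q =
      subst (λ pq → ValidAnswer x pq (answer ans r p q)) (lookup-queries r p q) (valid (index r p q))

    winners-cover : ∀ s → Covers x c (2t s) → Covers x (winners ans) (2t (suc s))
    winners-cover s cover j =
      let i , j≤i = cover j
          p , r , combine≡i = combine-surjective {suc g} {R} i
      in r , via-winner p r (subst (λ i → x j ℚ.≤ x (c i) ℚ.+ 2t s) (sym combine≡i) j≤i)
      where
      via-winner : ∀ p r → x j ℚ.≤ x (member r p) ℚ.+ 2t s → x j ℚ.≤ x (winners ans r) ℚ.+ 2t (suc s)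
      via-winner p r j≤p = begin
        x j                                    ≤⟨ j≤p ⟩
        x (member r p) ℚ.+ 2t s                ≤⟨ ℚ.+-monoˡ-≤ (2t s) p≤winner ⟩
        x (winners ans r) ℚ.+ 2t 1 ℚ.+ 2t s    ≡⟨ ℚ.+-assoc (x (winners ans r)) (2t 1) (2t s) ⟩
        x (winners ans r) ℚ.+ (2t 1 ℚ.+ 2t s)  ≡⟨ cong (x (winners ans r) ℚ.+_) (2t-+ 1 s) ⟨
        x (winners ans r) ℚ.+ 2t (suc s)       ∎
        where
        open ℚ.≤-Reasoning
        p≤winner : x (member r p) ℚ.≤ x (winners ans r) ℚ.+ 2t 1
        p≤winner = topScorer-approx x (member r) (answer ans r) (answer-valid r) p

tournaments : ∀ {k r} (gs : Vec ℕ r) → (Fin (candidates gs) → Fin k) → Alg k r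
tournaments []       c = done (c zero)
tournaments (g ∷ gs) c = round queries (tournaments gs ∘ winners)
  where open Round g (candidates gs) c

tournaments-good : ∀ {k r} (x : Fin k → ℚ) (gs : Vec ℕ r) c s → Covers x c (2t s) →
                   GoodRun x (2t (s + r)) (queryCount gs) (tournaments gs c)
tournaments-good x []       c s cover j with cover j
... | zero , j≤c = subst (λ n → x j ℚ.≤ x (c zero) ℚ.+ 2t n) (sym (ℕ.+-identityʳ s)) j≤c
tournaments-good {r = suc r} x (g ∷ gs) c s cover = length≤ , λ ans valid →
  subst₂ (λ n b → GoodRun x (2t n) b (tournaments gs (winners ans))) (sym (ℕ.+-suc s r)) (sym remaining)
    (tournaments-good x gs (winners ans) (suc s) (winners-cover x ans valid s cover))
  where
  open Round g (candidates gs) c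
  length≡ : length queries ≡ suc g * suc g * candidates gs
  length≡ = length-tabulate pairs
  length≤ : length queries ≤ queryCount (g ∷ gs)
  length≤ = subst (_≤ queryCount (g ∷ gs)) (sym length≡) (ℕ.m≤m+n (suc g * suc g * candidates gs) (queryCount gs))
  remaining : queryCount (g ∷ gs) ∸ length queries ≡ queryCount gs
  remaining = trans (cong (queryCount (g ∷ gs) ∸_) length≡) (ℕ.m+n∸m≡n (suc g * suc g * candidates gs) (queryCount gs))

wrap : ∀ {n} k → Fin n → Fin (suc k)
wrap k i = toℕ i mod suc k

wrap-surjective : ∀ {n} k → suc k ≤ n → ∀ j → ∃[ i ] wrap {n} k i ≡ j
wrap-surjective k 1+k≤n j = inject≤ j 1+k≤n , toℕ-injective (begin
  toℕ (wrap k (inject≤ j 1+k≤n))  ≡⟨ toℕ-fromℕ< (m%n<n (toℕ (inject≤ j 1+k≤n)) (suc k)) ⟩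
  toℕ (inject≤ j 1+k≤n) % suc k   ≡⟨ cong (_% suc k) (toℕ-inject≤ j 1+k≤n) ⟩
  toℕ j % suc k                   ≡⟨ m<n⇒m%n≡m (toℕ<n j) ⟩
  toℕ j                           ∎)
  where open ≡-Reasoning

surjection-covers : ∀ {k n} (x : Fin k → ℚ) (c : Fin n → Fin k) → (∀ j → ∃[ i ] c i ≡ j) → Covers x c 0ℚ
surjection-covers x c surjective j =
  let i , ci≡j = surjective j
  in i , ℚ.≤-reflexive (trans (sym (ℚ.+-identityʳ (x j))) (cong (λ j′ → x j′ ℚ.+ 0ℚ) (sym ci≡j)))

Schedule : ℕ → ℕ → ℕ → Set
Schedule r E B = ∃[ gs ] candidates {r} gs ≡ 2 ^ E × queryCount gs ≤ r * 2 ^ B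

schedule-∷ : ∀ {r d E B} → d + d + E ≤ B → Schedule r E B → Schedule (suc r) (d + E) B
schedule-∷ {r} {d} {E} {B} round≤B (gs , candidates≡ , queries≤) =
  pred (2 ^ d) ∷ gs , candidates≡′ , ℕ.+-mono-≤ round≤ queries≤
  where
  instance _ = ℕ.m^n≢0 2 d
  size≡ : suc (pred (2 ^ d)) ≡ 2 ^ d
  size≡ = ℕ.suc-pred (2 ^ d)
  candidates≡′ : suc (pred (2 ^ d)) * candidates gs ≡ 2 ^ (d + E)
  candidates≡′ = begin
    suc (pred (2 ^ d)) * candidates gs  ≡⟨ cong₂ _*_ size≡ candidates≡ ⟩
    2 ^ d * 2 ^ E                       ≡⟨ ℕ.^-distribˡ-+-* 2 d E ⟨
    2 ^ (d + E)                         ∎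
    where open ≡-Reasoning
  round≤ : suc (pred (2 ^ d)) * suc (pred (2 ^ d)) * candidates gs ≤ 2 ^ B
  round≤ = begin
    suc (pred (2 ^ d)) * suc (pred (2 ^ d)) * candidates gs  ≡⟨ cong₂ _*_ (cong₂ _*_ size≡ size≡) candidates≡ ⟩
    2 ^ d * 2 ^ d * 2 ^ E                                    ≡⟨ cong (_* 2 ^ E) (ℕ.^-distribˡ-+-* 2 d d) ⟨
    2 ^ (d + d) * 2 ^ E                                      ≡⟨ ℕ.^-distribˡ-+-* 2 (d + d) E ⟨
    2 ^ (d + d + E)                                          ≤⟨ ℕ.^-monoʳ-≤ 2 round≤B ⟩
    2 ^ B                                                    ∎
    where open ℕ.≤-Reasoning

-- The first round takes groups of size 2^d with d = min E F; the slack F grows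
-- by d, so with E ≤ (2^r − 1) F it doubles as long as candidates remain.
schedule : ∀ r {E F B} → E + F ≤ B → E + F ≤ 2 ^ r * F → Schedule r E B
schedule zero {E} {F} _ E+F≤F with ℕ.n≤0⇒n≡0 (ℕ.+-cancelʳ-≤ F E 0 (subst (E + F ≤_) (ℕ.*-identityˡ F) E+F≤F))
... | refl = [] , refl , z≤n
schedule (suc r) {E} {F} {B} E+F≤B E+F≤2^[1+r]F with ℕ.≤-total E F
... | inj₁ E≤F = subst (λ E′ → Schedule (suc r) E′ B) (ℕ.+-identityʳ E)
      (schedule-∷ {d = E} (ℕ.≤-trans (ℕ.≤-reflexive (ℕ.+-identityʳ (E + E))) (ℕ.≤-trans (ℕ.+-monoʳ-≤ E E≤F) E+F≤B))
                  (schedule r {0} {E + F} E+F≤B (ℕ.m≤n*m (E + F) (2 ^ r) {{ℕ.m^n≢0 2 r}})))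
... | inj₂ F≤E with ℕ.m≤n⇒∃[o]m+o≡n F≤E
...   | E′ , refl = schedule-∷ {d = F} (ℕ.≤-trans (ℕ.≤-reflexive (swap F E′)) E+F≤B)
      (schedule r {E′} {F + F} (ℕ.≤-trans (ℕ.≤-reflexive (sym (shift F E′))) E+F≤B)
                  (subst₂ _≤_ (shift F E′) (double (2 ^ r) F) E+F≤2^[1+r]F))
  where
  swap : ∀ F E′ → F + F + E′ ≡ F + E′ + F
  swap = solve-∀
  shift : ∀ F E′ → F + E′ + F ≡ E′ + (F + F)
  shift = solve-∀
  double : ∀ P F → 2 * P * F ≡ P * (F + F)
  double = solve-∀

^-distribʳ-* : ∀ m n o → (m * n) ^ o ≡ m ^ o * n ^ o
^-distribʳ-* m n zero    = refl
^-distribʳ-* m n (suc o) = begin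
  m * n * (m * n) ^ o      ≡⟨ cong (m * n *_) (^-distribʳ-* m n o) ⟩
  m * n * (m ^ o * n ^ o)  ≡⟨ ℕ.[m*n]*[o*p]≡[m*o]*[n*p] m n (m ^ o) (n ^ o) ⟩
  m * m ^ o * (n * n ^ o)  ∎
  where open ≡-Reasoning

1+n≤2^e≤2[1+n] : ∀ n → ∃[ e ] suc n ≤ 2 ^ e × 2 ^ e ≤ 2 * suc n
1+n≤2^e≤2[1+n] zero = 0 , ℕ.≤-refl , ℕ.m≤n*m 1 2
1+n≤2^e≤2[1+n] (suc n) with 1+n≤2^e≤2[1+n] n
... | e , 1+n≤2^e , 2^e≤2[1+n] with suc (suc n) ℕ.≤? 2 ^ e
...   | yes 2+n≤2^e = e , 2+n≤2^e , ℕ.≤-trans 2^e≤2[1+n] (ℕ.*-monoʳ-≤ 2 (ℕ.n≤1+n (suc n)))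
...   | no  2+n≰2^e = suc e , subst (suc (suc n) ≤_) (sym 2^[1+e]≡2[1+n]) (ℕ.m<m+n (suc n) (s≤s z≤n))
                            , ℕ.≤-trans (ℕ.≤-reflexive 2^[1+e]≡2[1+n]) (ℕ.*-monoʳ-≤ 2 (ℕ.n≤1+n (suc n)))
  where
  2^[1+e]≡2[1+n] : 2 ^ suc e ≡ 2 * suc n
  2^[1+e]≡2[1+n] = cong (2 *_) (ℕ.≤-antisym (ℕ.≤-pred (ℕ.≰⇒> 2+n≰2^e)) 1+n≤2^e)

m≤[1+m/n]*n : ∀ m n .{{_ : NonZero n}} → m ≤ suc (m / n) * n
m≤[1+m/n]*n m n = begin
  m                  ≡⟨ m≡m%n+[m/n]*n m n ⟩
  m % n + m / n * n  ≤⟨ ℕ.+-monoˡ-≤ (m / n * n) (ℕ.<⇒≤ (m%n<n m n)) ⟩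
  n + m / n * n      ∎
  where open ℕ.≤-Reasoning

[2^[e+L]]^N≤8^N*k^[1+N] : ∀ {e L N} k → 1 ≤ N → 2 ^ e ≤ 2 * k → L * N ≤ N + e →
                          (2 ^ (e + L)) ^ N ≤ 8 ^ N * k ^ suc N
[2^[e+L]]^N≤8^N*k^[1+N] {e} {L} {N} k 1≤N 2^e≤2k LN≤N+e = begin
  (2 ^ (e + L)) ^ N              ≡⟨ ℕ.^-*-assoc 2 (e + L) N ⟩
  2 ^ ((e + L) * N)              ≤⟨ ℕ.^-monoʳ-≤ 2 exponent≤ ⟩
  2 ^ (e * suc N + N)            ≡⟨ ℕ.^-distribˡ-+-* 2 (e * suc N) N ⟩
  2 ^ (e * suc N) * 2 ^ N        ≡⟨ cong (_* 2 ^ N) (ℕ.^-*-assoc 2 e (suc N)) ⟨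
  (2 ^ e) ^ suc N * 2 ^ N        ≤⟨ ℕ.*-monoˡ-≤ (2 ^ N) (ℕ.^-monoˡ-≤ (suc N) 2^e≤2k) ⟩
  (2 * k) ^ suc N * 2 ^ N        ≡⟨ cong (_* 2 ^ N) (^-distribʳ-* 2 k (suc N)) ⟩
  2 ^ suc N * k ^ suc N * 2 ^ N  ≡⟨ swap (2 ^ suc N) (k ^ suc N) (2 ^ N) ⟩
  2 ^ suc N * 2 ^ N * k ^ suc N  ≡⟨ cong (_* k ^ suc N) (ℕ.^-distribˡ-+-* 2 (suc N) N) ⟨
  2 ^ (suc N + N) * k ^ suc N    ≤⟨ ℕ.*-monoˡ-≤ (k ^ suc N) (ℕ.^-monoʳ-≤ 2 1+N+N≤3N) ⟩
  2 ^ (3 * N) * k ^ suc N        ≡⟨ cong (_* k ^ suc N) (ℕ.^-*-assoc 2 3 N) ⟨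
  8 ^ N * k ^ suc N              ∎
  where
  open ℕ.≤-Reasoning
  swap : ∀ a b c → a * b * c ≡ a * c * b
  swap = solve-∀
  rearrange : ∀ e N → e * N + (N + e) ≡ e * suc N + N
  rearrange = solve-∀
  triple : ∀ N → N + N + N ≡ 3 * N
  triple = solve-∀
  exponent≤ : (e + L) * N ≤ e * suc N + N
  exponent≤ = begin
    (e + L) * N      ≡⟨ ℕ.*-distribʳ-+ N e L ⟩
    e * N + L * N    ≤⟨ ℕ.+-monoʳ-≤ (e * N) LN≤N+e ⟩
    e * N + (N + e)  ≡⟨ rearrange e N ⟩
    e * suc N + N    ∎
  1+N+N≤3N : suc N + N ≤ 3 * N
  1+N+N≤3N = ℕ.≤-trans (ℕ.+-monoˡ-≤ N (ℕ.+-monoˡ-≤ N 1≤N)) (ℕ.≤-reflexive (triple N))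

tournaments-achieve : ∀ t N k → 1 ≤ N → 2 ^ t ≡ suc N →
  Σ (Alg (suc k) t) λ A → ∃ λ b → Achieves A (2t t) b × b ^ N ≤ (8 * t) ^ N * suc k ^ (2 ^ t)
tournaments-achieve t N k 1≤N 2^t≡1+N with 1+n≤2^e≤2[1+n] k
... | e , 1+k≤2^e , 2^e≤2[1+k] =
  let gs , candidates≡ , queries≤ = schedule t {e} {L} ℕ.≤-refl e+L≤2^t*L
      c = wrap {candidates gs} k
      covers x = surjection-covers x c (wrap-surjective k (subst (suc k ≤_) (sym candidates≡) 1+k≤2^e))
  in tournaments gs c , queryCount gs , (λ x → tournaments-good x gs c 0 (covers x)) , query-bound queries≤
  where
  instance _ = >-nonZero 1≤N
  L : ℕ
  L = suc (e / N)
  e+L≤2^t*L : e + L ≤ 2 ^ t * L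
  e+L≤2^t*L = begin
    e + L      ≤⟨ ℕ.+-monoˡ-≤ L (m≤[1+m/n]*n e N) ⟩
    L * N + L  ≡⟨ reorder L N ⟩
    suc N * L  ≡⟨ cong (_* L) 2^t≡1+N ⟨
    2 ^ t * L  ∎
    where
    open ℕ.≤-Reasoning
    reorder : ∀ L N → L * N + L ≡ suc N * L
    reorder = solve-∀
  query-bound : ∀ {b} → b ≤ t * 2 ^ (e + L) → b ^ N ≤ (8 * t) ^ N * suc k ^ (2 ^ t)
  query-bound {b} b≤ = begin
    b ^ N                                ≤⟨ ℕ.^-monoˡ-≤ N b≤ ⟩
    (t * 2 ^ (e + L)) ^ N                ≡⟨ ^-distribʳ-* t (2 ^ (e + L)) N ⟩
    t ^ N * (2 ^ (e + L)) ^ N            ≤⟨ ℕ.*-monoʳ-≤ (t ^ N) (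
                                            [2^[e+L]]^N≤8^N*k^[1+N] (suc k) 1≤N 2^e≤2[1+k]
                                              (ℕ.+-monoʳ-≤ N (m/n*n≤m e N))) ⟩
    t ^ N * (8 ^ N * suc k ^ suc N)      ≡⟨ ℕ.*-assoc (t ^ N) (8 ^ N) _ ⟨
    t ^ N * 8 ^ N * suc k ^ suc N        ≡⟨ cong (_* suc k ^ suc N) (ℕ.*-comm (t ^ N) (8 ^ N)) ⟩
    8 ^ N * t ^ N * suc k ^ suc N        ≡⟨ cong (_* suc k ^ suc N) (^-distribʳ-* 8 t N) ⟨
    (8 * t) ^ N * suc k ^ suc N          ≡⟨ cong (λ n → (8 * t) ^ N * suc k ^ n) 2^t≡1+N ⟨
    (8 * t) ^ N * suc k ^ (2 ^ t)        ∎
    where open ℕ.≤-Reasoning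

lemma5p11 : ∃ λ (C : ℕ) → ∀ (t : ℕ) → 1 ≤ t → ∀ (k : ℕ) → 1 ≤ k →
    Σ (Alg k t) λ A → ∃ λ (b : ℕ) →
      Achieves A (2t t) b ×
      (b ^ (2 ^ t ∸ 1) ≤ (C * t) ^ (2 ^ t ∸ 1) * k ^ (2 ^ t))
lemma5p11 = 8 , λ where
  t _   zero    ()
  t 1≤t (suc k) _ → tournaments-achieve t (2 ^ t ∸ 1) k
    (ℕ.∸-monoˡ-≤ 1 (ℕ.^-monoʳ-≤ 2 1≤t))
    (sym (ℕ.m+[n∸m]≡n (ℕ.m^n>0 2 t)))
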